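{- Let $M(K(n_1,\dots,n_k))$ be the middle graph of the complete $k$-partite graph $K(n_1,\dots,n_k)$, and let $\Delta$ be its maximum degree. Let $n=\sum_{i=1}^k n_i$ and $l=\frac12\sum_{i=1}^k n_i(n-n_i)$. Then $\chi_\Delta(M(K(n_1,\dots,n_k)))=k+l$.
   Context: The complete $k$-partite graph $K(n_1,\dots,n_k)$ has vertex set $V_1\cup\dots\cup V_k$ (pairwise disjoint, $|V_i|=n_i$), with each vertex of $V_i$ adjacent exactly to all vertices outside $V_i$. The middle graph $M(G)$ of $G$ has vertex set $V(G)\cup E(G)$, two of its vertices being adjacent iff they are two edges of $G$ sharing an endpoint, or one is a vertex and the other an edge of $G$ incident with it. All graphs are simple, connected and undirected; $N_G(v)$ is the open neighborhood, $d(v)=|N_G(v)|$, $\Delta$ the maximum degree. For a coloring $c$ and vertex set $S$, $c(S)=\{c(u):u\in S\}$. For integers $k'>0$ and $0<r\le\Delta(G)$ with $r\le k'$, a conditional $(k',r)$-coloring of $G$ is a surjective map $c:V(G)\to\{1,\dots,k'\}$ such that (C1) $c(u)\ne c(v)$ whenever $uv\in E(G)$, and (C2) $|c(N_G(v))|\ge\min\{d(v),r\}$ for every vertex $v$. $\chi_r(G)$ is the smallest $k'$ for which $G$ has a conditional $(k',r)$-coloring. -}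

module Defs where

open import Data.Nat using (ℕ; zero; suc; _+_; _*_; _∸_; _≤_; _<_; _⊓_; _⊔_; ⌊_/2⌋)
open import Data.Nat.Properties using (_<?_)
open import Data.Fin using (Fin; toℕ)
open import Data.Fin.Properties using (_≟_)
open import Data.List using (List; []; _∷_; map; _++_; concatMap; filterᵇ; length; lookup; upTo; foldr)
open import Data.Bool.ListAction using (any)
open import Data.List.Relation.Unary.Any using (Any)
open import Data.Bool using (Bool; true; false; _∧_; _∨_; not)
open import Data.Product using (_×_; _,_; proj₁; proj₂; ∃)
open import Data.Sum using (_⊎_; inj₁; inj₂)
open import Relation.Nullary using (¬_; does)
open import Relation.Binary.PropositionalEquality using (_≡_)

allFin : (n : ℕ) → List (Fin n)
allFin n = Data.List.allFin n

record Graph : Set where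
  field
    size : ℕ
    adj  : Fin size → Fin size → Bool
open Graph public

countTrue : List Bool → ℕ
countTrue [] = 0
countTrue (true ∷ bs) = suc (countTrue bs)
countTrue (false ∷ bs) = countTrue bs

deg : (G : Graph) → Fin (size G) → ℕ
deg G v = countTrue (map (adj G v) (allFin (size G)))

maxDeg : Graph → ℕ
maxDeg G = foldr _⊔_ 0 (map (deg G) (allFin (size G)))

nbColours : (G : Graph) {k : ℕ} → (Fin (size G) → Fin k) → Fin (size G) → ℕ
nbColours G {k} c v =
  countTrue (map (λ j → any (λ u → adj G v u ∧ does (c u ≟ j)) (allFin (size G))) (allFin k))

record CondColouring (G : Graph) (k' r : ℕ) : Set where
  field
    k'-pos  : 0 < k'
    r-pos   : 0 < r
    r≤Δ     : r ≤ maxDeg G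
    r≤k'    : r ≤ k'
    colour  : Fin (size G) → Fin k'
    surj    : ∀ (j : Fin k') → ∃ λ v → colour v ≡ j
    proper  : ∀ u v → adj G u v ≡ true → ¬ (colour u ≡ colour v)
    cond    : ∀ v → deg G v ⊓ r ≤ nbColours G colour v

IsCondChromatic : Graph → (r m : ℕ) → Set
IsCondChromatic G r m = CondColouring G m r × (∀ k' → CondColouring G k' r → m ≤ k')

-- Complete k-partite graph K(n_1,…,n_k).
-- Vertices are labelled (i , a) with i : Fin k the part and a < n i.

kpLabels : (k : ℕ) → (Fin k → ℕ) → List (Fin k × ℕ)
kpLabels k n = concatMap (λ i → map (i ,_) (upTo (n i))) (allFin k)

completeMultipartite : (k : ℕ) → (Fin k → ℕ) → Graph
completeMultipartite k n = record
  { size = length (kpLabels k n)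
  ; adj  = λ a b → not (does (proj₁ (lookup (kpLabels k n) a) ≟ proj₁ (lookup (kpLabels k n) b)))
  }

-- Middle graph M(G): vertices V(G) ∪ E(G); an edge is encoded as the pair
-- (u , v) with toℕ u < toℕ v and adj u v.

edgeList : (G : Graph) → List (Fin (size G) × Fin (size G))
edgeList G = filterᵇ (λ e → adj G (proj₁ e) (proj₂ e) ∧ does (toℕ (proj₁ e) <? toℕ (proj₂ e)))
               (concatMap (λ u → map (u ,_) (allFin (size G))) (allFin (size G)))

middleLabels : (G : Graph) → List (Fin (size G) ⊎ (Fin (size G) × Fin (size G)))
middleLabels G = map inj₁ (allFin (size G)) ++ map inj₂ (edgeList G)

middleAdj : (G : Graph) → (x y : Fin (size G) ⊎ (Fin (size G) × Fin (size G))) → Bool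
middleAdj G (inj₁ v) (inj₁ w) = false
middleAdj G (inj₁ v) (inj₂ (a , b)) = does (v ≟ a) ∨ does (v ≟ b)
middleAdj G (inj₂ (a , b)) (inj₁ v) = does (v ≟ a) ∨ does (v ≟ b)
middleAdj G (inj₂ (a , b)) (inj₂ (c , d)) =
  not (does (a ≟ c) ∧ does (b ≟ d))
  ∧ (does (a ≟ c) ∨ does (a ≟ d) ∨ does (b ≟ c) ∨ does (b ≟ d))

middleGraph : Graph → Graph
middleGraph G = record
  { size = length (middleLabels G)
  ; adj  = λ i j → middleAdj G (lookup (middleLabels G) i) (lookup (middleLabels G) j)
  }

sumFin : (k : ℕ) → (Fin k → ℕ) → ℕ
sumFin k f = foldr _+_ 0 (map f (allFin k))

-- Colour each vertex of K = K(n₁,…,nₖ) by its part and each edge by a colour of its own. In M(K)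
-- the neighbours of a vertex are edges and the neighbours of an edge are its two endpoints (which lie
-- in different parts) and further edges, so every neighbourhood is rainbow: this is a conditional
-- (k + |E|, Δ)-colouring. Conversely, for r = Δ condition (C2) forces every neighbourhood to be
-- rainbow, so two vertices of M(K) at distance at most two get different colours. One vertex from
-- each part together with all edges of K are pairwise at distance at most two, so k + |E| ≤ k′.
-- Finally 2|E| = Σᵢ nᵢ(n − nᵢ) by the handshake lemma.
module Submission where

open import Defs
open import Data.Bool using (Bool; true; false; _∧_; _∨_; not)
open import Data.Bool.ListAction using (any)
open import Data.Fin using (Fin; zero; suc; toℕ; _↑ˡ_; _↑ʳ_; splitAt; join)
open import Data.Fin.Properties as Finₚ using (_≟_; toℕ-injective; ↑ˡ-injective; ↑ʳ-injective; splitAt-↑ˡ; splitAt-↑ʳ; splitAt⁻¹-↑ˡ; splitAt⁻¹-↑ʳ; join-splitAt; injective⇒≤)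
open import Data.List using (List; []; _∷_; map; _++_; concatMap; filterᵇ; length; lookup; foldr; upTo)
open import Data.List.Membership.Propositional using (_∈_)
open import Data.List.Membership.Propositional.Properties using (∈-filter⁺; ∈-filter⁻; ∈-allFin; ∈-lookup; ∈-map⁺; ∈-map⁻; ∈-++⁺ˡ; ∈-++⁺ʳ; ∈-concatMap⁺; ∈-upTo⁺)
open import Data.List.Properties using (map-++; map-tabulate; tabulate-lookup; length-map; length-upTo; length-tabulate)
open import Data.List.Relation.Unary.All as All using ()
open import Data.List.Relation.Unary.Any as Any using (here; there)
open import Data.List.Relation.Unary.Any.Properties using (lookup-index)
open import Data.List.Relation.Unary.Unique.Propositional using (Unique; []; _∷_)
open import Data.List.Relation.Unary.Unique.Propositional.Properties using (allFin⁺; map⁺)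
open import Data.Nat using (ℕ; zero; suc; _+_; _*_; _∸_; _≤_; _<_; _⊔_; ⌊_/2⌋; z≤n; s≤s)
open import Data.Nat.ListAction using (sum)
open import Data.Nat.ListAction.Properties using (sum-++)
open import Data.Nat.Properties hiding (_≟_)
open import Data.Product using (_×_; _,_; proj₁; proj₂; ∃)
open import Data.Product.Properties using (≡-dec)
open import Relation.Binary.Definitions using (tri<; tri≈; tri>)
open import Data.Sum using (_⊎_; inj₁; inj₂; [_,_]′; map₁)
open import Data.Sum.Properties using (inj₁-injective)
open import Relation.Nullary.Decidable using (_⊎-dec_)
open import Function.Bundles using (Equivalence)
open import Function using (_∘_)
open import Relation.Nullary using (¬_; Dec; does; yes; no; contradiction)
open import Relation.Nullary.Decidable using (dec-true; dec-false)
open import Data.Bool.Properties using (T-≡; T-∧; T?; ∨-zeroʳ; ∧-identityʳ; ∧-zeroʳ; ¬-not)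
open import Relation.Binary.PropositionalEquality
open import Algebra.Properties.CommutativeSemigroup +-commutativeSemigroup using () renaming (interchange to +-interchange; x∙yz≈y∙xz to +-exchangeˡ)

iverson : Bool → ℕ
iverson true  = 1
iverson false = 0

sumOver : {A : Set} → List A → (A → ℕ) → ℕ
sumOver xs f = sum (map f xs)

count : {A : Set} → (A → Bool) → List A → ℕ
count p xs = countTrue (map p xs)

module _ {A : Set} where

  sumOver-cong : (xs : List A) {f g : A → ℕ} → (∀ x → f x ≡ g x) → sumOver xs f ≡ sumOver xs g
  sumOver-cong []       f≗g = refl
  sumOver-cong (x ∷ xs) f≗g = cong₂ _+_ (f≗g x) (sumOver-cong xs f≗g)

  sumOver-++ : (xs ys : List A) (f : A → ℕ) → sumOver (xs ++ ys) f ≡ sumOver xs f + sumOver ys f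
  sumOver-++ xs ys f = trans (cong sum (map-++ f xs ys)) (sum-++ (map f xs) (map f ys))

  sumOver-+ : (xs : List A) (f g : A → ℕ) → sumOver xs (λ x → f x + g x) ≡ sumOver xs f + sumOver xs g
  sumOver-+ []       f g = refl
  sumOver-+ (x ∷ xs) f g = begin
    f x + g x + sumOver xs (λ x → f x + g x)  ≡⟨ cong (f x + g x +_) (sumOver-+ xs f g) ⟩
    f x + g x + (sumOver xs f + sumOver xs g) ≡⟨ +-interchange (f x) (g x) _ _ ⟩
    f x + sumOver xs f + (g x + sumOver xs g) ∎
    where open ≡-Reasoning

  sumOver-const : (xs : List A) (c : ℕ) → sumOver xs (λ _ → c) ≡ length xs * c
  sumOver-const []       c = refl
  sumOver-const (x ∷ xs) c = cong (c +_) (sumOver-const xs c)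

  count≡sumOver-iverson : (p : A → Bool) (xs : List A) → count p xs ≡ sumOver xs (iverson ∘ p)
  count≡sumOver-iverson p [] = refl
  count≡sumOver-iverson p (x ∷ xs) with p x
  ... | true  = cong suc (count≡sumOver-iverson p xs)
  ... | false = count≡sumOver-iverson p xs

  length-filterᵇ : (p : A → Bool) (xs : List A) → length (filterᵇ p xs) ≡ count p xs
  length-filterᵇ p [] = refl
  length-filterᵇ p (x ∷ xs) with p x
  ... | true  = cong suc (length-filterᵇ p xs)
  ... | false = length-filterᵇ p xs

  count≤length : (p : A → Bool) (xs : List A) → count p xs ≤ length xs
  count≤length p [] = z≤n
  count≤length p (x ∷ xs) with p x
  ... | true  = s≤s (count≤length p xs)
  ... | false = m≤n⇒m≤1+n (count≤length p xs)

  count-false : (xs : List A) → count (λ _ → false) xs ≡ 0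
  count-false []       = refl
  count-false (x ∷ xs) = count-false xs

  count-∈ : (p : A → Bool) {x : A} {xs : List A} → x ∈ xs → p x ≡ true → 1 ≤ count p xs
  count-∈ p {xs = y ∷ xs} (here refl) px rewrite px = s≤s z≤n
  count-∈ p {xs = y ∷ xs} (there x∈xs) px with p y
  ... | true  = s≤s z≤n
  ... | false = count-∈ p x∈xs px

module _ {A B : Set} where

  sumOver-map : (g : A → B) (xs : List A) (f : B → ℕ) → sumOver (map g xs) f ≡ sumOver xs (f ∘ g)
  sumOver-map g []       f = refl
  sumOver-map g (x ∷ xs) f = cong (f (g x) +_) (sumOver-map g xs f)

  sumOver-concatMap : (h : A → List B) (xs : List A) (f : B → ℕ) →
                      sumOver (concatMap h xs) f ≡ sumOver xs (λ x → sumOver (h x) f)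
  sumOver-concatMap h []       f = refl
  sumOver-concatMap h (x ∷ xs) f =
    trans (sumOver-++ (h x) (concatMap h xs) f) (cong (sumOver (h x) f +_) (sumOver-concatMap h xs f))

  sumOver-swap : (xs : List A) (ys : List B) (f : A → B → ℕ) →
                 sumOver xs (λ x → sumOver ys (f x)) ≡ sumOver ys (λ y → sumOver xs (λ x → f x y))
  sumOver-swap []       ys f = sym (trans (sumOver-const ys 0) (*-zeroʳ (length ys)))
  sumOver-swap (x ∷ xs) ys f =
    trans (cong (sumOver ys (f x) +_) (sumOver-swap xs ys f)) (sym (sumOver-+ ys (f x) _))

sumOver-allFin-suc : (K : ℕ) (f : Fin (suc K) → ℕ) → sumOver (allFin (suc K)) f ≡ f zero + sumOver (allFin K) (f ∘ suc)
sumOver-allFin-suc K f =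
  cong (λ xs → f zero + sum xs) (trans (map-tabulate suc f) (sym (map-tabulate (λ i → i) (f ∘ suc))))

sumOver-lookup : {A : Set} (xs : List A) (f : A → ℕ) → sumOver (allFin (length xs)) (f ∘ lookup xs) ≡ sumOver xs f
sumOver-lookup xs f = trans (sym (sumOver-map (lookup xs) (allFin (length xs)) f))
  (cong (λ ys → sumOver ys f) (trans (map-tabulate (λ i → i) (lookup xs)) (tabulate-lookup xs)))

sumFin-except : (K : ℕ) (f : Fin K → ℕ) (j : Fin K) →
                sumFin K (λ i → f i * iverson (not (does (j ≟ i)))) + f j ≡ sumFin K f
sumFin-except (suc K) f zero
  rewrite sumOver-allFin-suc K (λ i → f i * iverson (not (does (zero ≟ i)))) | sumOver-allFin-suc K f
        | *-zeroʳ (f zero) | sumOver-cong (allFin K) (λ i → *-identityʳ (f (suc i))) = +-comm _ (f zero)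
sumFin-except (suc K) f (suc j)
  rewrite sumOver-allFin-suc K (λ i → f i * iverson (not (does (suc j ≟ i)))) | sumOver-allFin-suc K f
        | *-identityʳ (f zero) = trans (+-assoc (f zero) _ (f (suc j))) (cong (f zero +_) (sumFin-except K (f ∘ suc) j))

count-allFin-suc : (K : ℕ) (p : Fin (suc K) → Bool) → count p (allFin (suc K)) ≡ iverson (p zero) + count (p ∘ suc) (allFin K)
count-allFin-suc K p rewrite map-tabulate suc p | sym (map-tabulate (λ i → i) (p ∘ suc)) with p zero
... | true  = refl
... | false = refl

count-insert : (K : ℕ) (a : Fin K) (g : Fin K → Bool) →
               count (λ j → does (a ≟ j) ∨ g j) (allFin K) ≡ iverson (not (g a)) + count g (allFin K)
count-insert (suc K) zero g
  rewrite count-allFin-suc K (λ j → does (zero ≟ j) ∨ g j) | count-allFin-suc K g with g zero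
... | true  = refl
... | false = refl
count-insert (suc K) (suc a) g
  rewrite count-allFin-suc K (λ j → does (suc a ≟ j) ∨ g j) | count-allFin-suc K g
        | count-insert K a (g ∘ suc) = +-exchangeˡ (iverson (g zero)) (iverson (not (g (suc a)))) _

module ColourCount {X : Set} {K : ℕ} (p : X → Bool) (f : X → Fin K) where

  colourOccurs : List X → Fin K → Bool
  colourOccurs xs j = any (λ u → p u ∧ does (f u ≟ j)) xs

  #colours : List X → ℕ
  #colours xs = count (colourOccurs xs) (allFin K)

  InjectiveOn : List X → Set
  InjectiveOn xs = ∀ {u w} → u ∈ xs → w ∈ xs → p u ≡ true → p w ≡ true → f u ≡ f w → u ≡ w

  #colours≤K : (xs : List X) → #colours xs ≤ K
  #colours≤K xs = subst (#colours xs ≤_) (length-tabulate (λ i → i)) (count≤length _ (allFin K))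

  #colours-insert : (x : X) (xs : List X) {b : Bool} → colourOccurs xs (f x) ≡ b →
                    count (λ j → does (f x ≟ j) ∨ colourOccurs xs j) (allFin K) ≡ iverson (not b) + #colours xs
  #colours-insert x xs refl = count-insert K (f x) (colourOccurs xs)

  colourOccurs-∈ : {w : X} {xs : List X} → w ∈ xs → p w ≡ true → colourOccurs xs (f w) ≡ true
  colourOccurs-∈ {w} (here refl) pw rewrite pw | dec-true (f w ≟ f w) refl = refl
  colourOccurs-∈ {w} {x ∷ xs} (there w∈xs) pw
    rewrite colourOccurs-∈ w∈xs pw = ∨-zeroʳ (p x ∧ does (f x ≟ f w))

  colourOccurs⁻ : (xs : List X) (j : Fin K) → colourOccurs xs j ≡ true → ∃ λ u → u ∈ xs × p u ≡ true × f u ≡ j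
  colourOccurs⁻ (x ∷ xs) j occ with p x in px | f x ≟ j
  ... | true  | yes fx≡j = x , here refl , px , fx≡j
  ... | true  | no _     = let u , u∈ , pu , fu≡j = colourOccurs⁻ xs j occ in u , there u∈ , pu , fu≡j
  ... | false | _        = let u , u∈ , pu , fu≡j = colourOccurs⁻ xs j occ in u , there u∈ , pu , fu≡j

  #colours≤count : (xs : List X) → #colours xs ≤ count p xs
  #colours≤count [] = ≤-reflexive (count-false (allFin K))
  #colours≤count (x ∷ xs) with p x in px
  ... | false = #colours≤count xs
  ... | true  = begin
    count (λ j → does (f x ≟ j) ∨ colourOccurs xs j) (allFin K) ≡⟨ #colours-insert x xs refl ⟩
    iverson (not (colourOccurs xs (f x))) + #colours xs         ≤⟨ +-mono-≤ (iverson≤1 _) (#colours≤count xs) ⟩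
    suc (count p xs)                                            ∎
    where
    open ≤-Reasoning
    iverson≤1 : (b : Bool) → iverson b ≤ 1
    iverson≤1 true  = s≤s z≤n
    iverson≤1 false = z≤n

  count≤#colours⇒injectiveOn : (xs : List X) → count p xs ≤ #colours xs → InjectiveOn xs
  count≤#colours⇒injectiveOn (x ∷ xs) le {u} {w} u∈ w∈ pu pw fu≡fw with p x in px
  ... | false = injective u∈ w∈
    where
    injective : u ∈ x ∷ xs → w ∈ x ∷ xs → u ≡ w
    injective (here refl) _           = contradiction (trans (sym pu) px) λ ()
    injective (there _)   (here refl) = contradiction (trans (sym pw) px) λ ()
    injective (there u∈xs) (there w∈xs) = count≤#colours⇒injectiveOn xs le u∈xs w∈xs pu pw fu≡fw
  ... | true with colourOccurs xs (f x) in occ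
  ...   | true  = contradiction (≤-trans (≤-trans le (≤-reflexive (#colours-insert x xs occ))) (#colours≤count xs)) (n≮n _)
  ...   | false = injective u∈ w∈
    where
    le′ : count p xs ≤ #colours xs
    le′ = ≤-pred (≤-trans le (≤-reflexive (#colours-insert x xs occ)))
    occurs : Fin K → Set
    occurs j = colourOccurs xs j ≡ true
    injective : u ∈ x ∷ xs → w ∈ x ∷ xs → u ≡ w
    injective (here refl)  (here refl)  = refl
    injective (here refl)  (there w∈xs) = contradiction (trans (sym occ) (subst occurs (sym fu≡fw) (colourOccurs-∈ w∈xs pw))) λ ()
    injective (there u∈xs) (here refl)  = contradiction (trans (sym occ) (subst occurs fu≡fw (colourOccurs-∈ u∈xs pu))) λ ()
    injective (there u∈xs) (there w∈xs) = count≤#colours⇒injectiveOn xs le′ u∈xs w∈xs pu pw fu≡fw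

  injectiveOn⇒count≤#colours : (xs : List X) → Unique xs → InjectiveOn xs → count p xs ≤ #colours xs
  injectiveOn⇒count≤#colours []       _              _   = z≤n
  injectiveOn⇒count≤#colours (x ∷ xs) (x∉xs ∷ uniq) inj with p x in px
  ... | false = ih
    where ih = injectiveOn⇒count≤#colours xs uniq λ u∈ w∈ → inj (there u∈) (there w∈)
  ... | true  = ≤-trans (s≤s ih) (≤-reflexive (sym (#colours-insert x xs fresh)))
    where
    ih = injectiveOn⇒count≤#colours xs uniq λ u∈ w∈ → inj (there u∈) (there w∈)
    fresh : colourOccurs xs (f x) ≡ false
    fresh = ¬-not λ occ → let u , u∈ , pu , fu≡fx = colourOccurs⁻ xs (f x) occ in
      All.lookup x∉xs u∈ (inj (here refl) (there u∈) px pu (sym fu≡fx))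

module _ (G : Graph) where

  deg≤maxDeg : (v : Fin (size G)) → deg G v ≤ maxDeg G
  deg≤maxDeg v = ∈⇒≤max (∈-allFin v)
    where
    ∈⇒≤max : {vs : List (Fin (size G))} → v ∈ vs → deg G v ≤ foldr _⊔_ 0 (map (deg G) vs)
    ∈⇒≤max {w ∷ _}  (here refl)  = m≤m⊔n (deg G w) _
    ∈⇒≤max {w ∷ vs} (there v∈vs) = ≤-trans (∈⇒≤max v∈vs) (m≤n⊔m (deg G w) _)

  maxDeg≤ : {b : ℕ} → (∀ v → deg G v ≤ b) → maxDeg G ≤ b
  maxDeg≤ {b} deg≤b = max≤ (allFin (size G))
    where
    max≤ : (vs : List (Fin (size G))) → foldr _⊔_ 0 (map (deg G) vs) ≤ b
    max≤ []       = z≤n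
    max≤ (v ∷ vs) = ⊔-lub (deg≤b v) (max≤ vs)

  adj⇒0<maxDeg : {x y : Fin (size G)} → adj G x y ≡ true → 0 < maxDeg G
  adj⇒0<maxDeg {x} {y} xy = ≤-trans (count-∈ (adj G x) (∈-allFin y) xy) (deg≤maxDeg x)

  NeighbourInjective : {k : ℕ} → (Fin (size G) → Fin k) → Fin (size G) → Set
  NeighbourInjective c v = ∀ {u w} → adj G v u ≡ true → adj G v w ≡ true → c u ≡ c w → u ≡ w

  module _ {k : ℕ} (c : Fin (size G) → Fin k) (v : Fin (size G)) where
    open ColourCount (adj G v) c

    nbColours≤k : nbColours G c v ≤ k
    nbColours≤k = #colours≤K (allFin (size G))

    neighbourInjective⇒deg≤nbColours : NeighbourInjective c v → deg G v ≤ nbColours G c v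
    neighbourInjective⇒deg≤nbColours inj =
      injectiveOn⇒count≤#colours (allFin (size G)) (allFin⁺ (size G)) λ _ _ → inj

    deg≤nbColours⇒neighbourInjective : deg G v ≤ nbColours G c v → NeighbourInjective c v
    deg≤nbColours⇒neighbourInjective le = count≤#colours⇒injectiveOn (allFin (size G)) le (∈-allFin _) (∈-allFin _)

  WithinTwo : Fin (size G) → Fin (size G) → Set
  WithinTwo x y = adj G x y ≡ true ⊎ ∃ λ z → adj G z x ≡ true × adj G z y ≡ true

  Clique² : {m : ℕ} → (Fin m → Fin (size G)) → Set
  Clique² ι = ∀ {s t} → s ≢ t → ι s ≢ ι t × WithinTwo (ι s) (ι t)

  module _ {k′ : ℕ} (c : CondColouring G k′ (maxDeg G)) where
    open CondColouring c

    neighbourInjective-Δ : ∀ v → NeighbourInjective colour v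
    neighbourInjective-Δ v = deg≤nbColours⇒neighbourInjective colour v
      (subst (_≤ nbColours G colour v) (m≤n⇒m⊓n≡m (deg≤maxDeg v)) (cond v))

    separatesWithinTwo-Δ : {x y : Fin (size G)} → x ≢ y → WithinTwo x y → colour x ≢ colour y
    separatesWithinTwo-Δ x≢y (inj₁ xy)             = proper _ _ xy
    separatesWithinTwo-Δ x≢y (inj₂ (z , zx , zy)) = x≢y ∘ neighbourInjective-Δ z zx zy

    clique²≤colours : {m : ℕ} {ι : Fin m → Fin (size G)} → Clique² ι → m ≤ k′
    clique²≤colours {ι = ι} clique = injective⇒≤ {f = colour ∘ ι} colours-differ
      where
      colours-differ : ∀ {s t} → colour (ι s) ≡ colour (ι t) → s ≡ t
      colours-differ {s} {t} same with s ≟ t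
      ... | yes s≡t = s≡t
      ... | no  s≢t = let ιs≢ιt , near = clique s≢t in contradiction same (separatesWithinTwo-Δ ιs≢ιt near)

module _ (G : Graph) (adj-sym : ∀ u v → adj G u v ≡ adj G v u) (adj-irrefl : ∀ v → adj G v v ≡ false) where

  private
    V : List (Fin (size G))
    V = allFin (size G)

    listed : Fin (size G) → Fin (size G) → ℕ
    listed u v = iverson (adj G u v ∧ does (toℕ u <? toℕ v))

    iverson-adj : ∀ u v → iverson (adj G u v) ≡ listed u v + listed v u
    iverson-adj u v with <-cmp (toℕ u) (toℕ v)
    ... | tri< u<v _ _
      rewrite dec-true (toℕ u <? toℕ v) u<v | dec-false (toℕ v <? toℕ u) (<⇒≯ u<v)
            | ∧-identityʳ (adj G u v) | ∧-zeroʳ (adj G v u) = sym (+-identityʳ _)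
    ... | tri> _ _ v<u
      rewrite dec-true (toℕ v <? toℕ u) v<u | dec-false (toℕ u <? toℕ v) (<⇒≯ v<u)
            | ∧-identityʳ (adj G v u) | ∧-zeroʳ (adj G u v) = cong iverson (adj-sym u v)
    ... | tri≈ _ u≡v _ with toℕ-injective u≡v
    ...   | refl rewrite adj-irrefl u = refl

    #edges≡listedSum : length (edgeList G) ≡ sumOver V (λ u → sumOver V (listed u))
    #edges≡listedSum = begin
      length (edgeList G)                                                ≡⟨ length-filterᵇ _ pairs ⟩
      count _ pairs                                                      ≡⟨ count≡sumOver-iverson _ pairs ⟩
      sumOver pairs (λ e → listed (proj₁ e) (proj₂ e))                   ≡⟨ sumOver-concatMap _ V _ ⟩
      sumOver V (λ u → sumOver (map (u ,_) V) (λ e → listed (proj₁ e) (proj₂ e)))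
                                                                         ≡⟨ sumOver-cong V (λ u → sumOver-map (u ,_) V _) ⟩
      sumOver V (λ u → sumOver V (listed u))                             ∎
      where
      open ≡-Reasoning
      pairs = concatMap (λ u → map (u ,_) V) V

  handshake : sumOver V (deg G) ≡ length (edgeList G) + length (edgeList G)
  handshake = begin
    sumOver V (deg G)
      ≡⟨ sumOver-cong V (λ u → count≡sumOver-iverson (adj G u) V) ⟩
    sumOver V (λ u → sumOver V (iverson ∘ adj G u))
      ≡⟨ sumOver-cong V (λ u → sumOver-cong V (iverson-adj u)) ⟩
    sumOver V (λ u → sumOver V (λ v → listed u v + listed v u))
      ≡⟨ sumOver-cong V (λ u → sumOver-+ V (listed u) (λ v → listed v u)) ⟩
    sumOver V (λ u → sumOver V (listed u) + sumOver V (λ v → listed v u))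
      ≡⟨ sumOver-+ V _ _ ⟩
    sumOver V (λ u → sumOver V (listed u)) + sumOver V (λ u → sumOver V (λ v → listed v u))
      ≡⟨ cong (sumOver V (λ u → sumOver V (listed u)) +_) (sumOver-swap V V (λ u v → listed v u)) ⟩
    sumOver V (λ u → sumOver V (listed u)) + sumOver V (λ v → sumOver V (listed v))
      ≡⟨ cong₂ _+_ #edges≡listedSum #edges≡listedSum ⟨
    length (edgeList G) + length (edgeList G)
      ∎
    where open ≡-Reasoning

module _ {A : Set} where

  leftPos : (xs ys : List A) → Fin (length xs) → Fin (length (xs ++ ys))
  leftPos (x ∷ xs) ys zero    = zero
  leftPos (x ∷ xs) ys (suc i) = suc (leftPos xs ys i)

  rightPos : (xs ys : List A) → Fin (length ys) → Fin (length (xs ++ ys))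
  rightPos []       ys j = j
  rightPos (x ∷ xs) ys j = suc (rightPos xs ys j)

  data Position (xs ys : List A) : Fin (length (xs ++ ys)) → Set where
    left  : (i : Fin (length xs)) → Position xs ys (leftPos xs ys i)
    right : (j : Fin (length ys)) → Position xs ys (rightPos xs ys j)

  position : (xs ys : List A) (p : Fin (length (xs ++ ys))) → Position xs ys p
  position []       ys p       = right p
  position (x ∷ xs) ys zero    = left zero
  position (x ∷ xs) ys (suc p) with position xs ys p
  ... | left i  = left (suc i)
  ... | right j = right j

  splitPos : (xs ys : List A) → Fin (length (xs ++ ys)) → Fin (length xs) ⊎ Fin (length ys)
  splitPos []       ys p       = inj₂ p
  splitPos (x ∷ xs) ys zero    = inj₁ zero
  splitPos (x ∷ xs) ys (suc p) = map₁ suc (splitPos xs ys p)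

  splitPos-leftPos : (xs ys : List A) (i : Fin (length xs)) → splitPos xs ys (leftPos xs ys i) ≡ inj₁ i
  splitPos-leftPos (x ∷ xs) ys zero    = refl
  splitPos-leftPos (x ∷ xs) ys (suc i) rewrite splitPos-leftPos xs ys i = refl

  splitPos-rightPos : (xs ys : List A) (j : Fin (length ys)) → splitPos xs ys (rightPos xs ys j) ≡ inj₂ j
  splitPos-rightPos []       ys j = refl
  splitPos-rightPos (x ∷ xs) ys j rewrite splitPos-rightPos xs ys j = refl

  lookup-leftPos : (xs ys : List A) (i : Fin (length xs)) → lookup (xs ++ ys) (leftPos xs ys i) ≡ lookup xs i
  lookup-leftPos (x ∷ xs) ys zero    = refl
  lookup-leftPos (x ∷ xs) ys (suc i) = lookup-leftPos xs ys i

  lookup-rightPos : (xs ys : List A) (j : Fin (length ys)) → lookup (xs ++ ys) (rightPos xs ys j) ≡ lookup ys j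
  lookup-rightPos []       ys j = refl
  lookup-rightPos (x ∷ xs) ys j = lookup-rightPos xs ys j

  rightPos-injective : (xs ys : List A) {j j′ : Fin (length ys)} → rightPos xs ys j ≡ rightPos xs ys j′ → j ≡ j′
  rightPos-injective []       ys eq = eq
  rightPos-injective (x ∷ xs) ys eq = rightPos-injective xs ys (Finₚ.suc-injective eq)

  lookup-injective : {xs : List A} → Unique xs → {i j : Fin (length xs)} → lookup xs i ≡ lookup xs j → i ≡ j
  lookup-injective {x ∷ xs} (x∉xs ∷ uniq) {zero}  {zero}  eq = refl
  lookup-injective {x ∷ xs} (x∉xs ∷ uniq) {zero}  {suc j} eq = contradiction eq (All.lookup x∉xs (∈-lookup j))
  lookup-injective {x ∷ xs} (x∉xs ∷ uniq) {suc i} {zero}  eq = contradiction (sym eq) (All.lookup x∉xs (∈-lookup i))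
  lookup-injective {x ∷ xs} (x∉xs ∷ uniq) {suc i} {suc j} eq = cong suc (lookup-injective uniq eq)

module MiddleGraph (G : Graph) where

  Vertex : Set
  Vertex = Fin (size G)

  Edge : Set
  Edge = Vertex × Vertex

  Label : Set
  Label = Vertex ⊎ Edge

  private
    edgeListed : Edge → Bool
    edgeListed e = adj G (proj₁ e) (proj₂ e) ∧ does (toℕ (proj₁ e) <? toℕ (proj₂ e))

    pairs : List Edge
    pairs = concatMap (λ u → map (u ,_) (allFin (size G))) (allFin (size G))

  ∈-edgeList⁻ : {e : Edge} → e ∈ edgeList G → adj G (proj₁ e) (proj₂ e) ≡ true
  ∈-edgeList⁻ e∈ = Equivalence.to T-≡ (proj₁ (Equivalence.to T-∧ (proj₂ (∈-filter⁻ (T? ∘ edgeListed) {xs = pairs} e∈))))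

  ∈-edgeList⁺ : {a b : Vertex} → adj G a b ≡ true → toℕ a < toℕ b → (a , b) ∈ edgeList G
  ∈-edgeList⁺ {a} {b} ab a<b = ∈-filter⁺ (T? ∘ edgeListed) (∈-concatMap⁺ _ (Any.map pair∈ (∈-allFin a)))
    (Equivalence.from T-≡ (cong₂ _∧_ ab (dec-true (toℕ a <? toℕ b) a<b)))
    where
    pair∈ : ∀ {u} → a ≡ u → (a , b) ∈ map (u ,_) (allFin (size G))
    pair∈ refl = ∈-map⁺ (a ,_) (∈-allFin b)

  _∈ₑ_ : Vertex → Edge → Set
  x ∈ₑ e = x ≡ proj₁ e ⊎ x ≡ proj₂ e

  _∈ₑ?_ : (x : Vertex) (e : Edge) → Dec (x ∈ₑ e)
  x ∈ₑ? e = (x ≟ proj₁ e) ⊎-dec (x ≟ proj₂ e)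

  vertexLabels : List Label
  vertexLabels = map inj₁ (allFin (size G))

  edgeLabels : List Label
  edgeLabels = map inj₂ (edgeList G)

  #E : ℕ
  #E = length edgeLabels

  M : Graph
  M = middleGraph G

  label : Fin (size M) → Label
  label = lookup (middleLabels G)

  Slot : Set
  Slot = Fin (length vertexLabels)

  vertexPos : Slot → Fin (size M)
  vertexPos = leftPos vertexLabels edgeLabels

  edgePos : Fin #E → Fin (size M)
  edgePos = rightPos vertexLabels edgeLabels

  middlePosition : (x : Fin (size M)) → Position vertexLabels edgeLabels x
  middlePosition = position vertexLabels edgeLabels

  vertexAt : Slot → Vertex
  vertexAt i = proj₁ (∈-map⁻ inj₁ (∈-lookup {xs = vertexLabels} i))

  label-vertexPos : (i : Slot) → label (vertexPos i) ≡ inj₁ (vertexAt i)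
  label-vertexPos i = trans (lookup-leftPos vertexLabels edgeLabels i) (proj₂ (proj₂ (∈-map⁻ inj₁ (∈-lookup {xs = vertexLabels} i))))

  edgeAt : Fin #E → Edge
  edgeAt j = proj₁ (∈-map⁻ inj₂ (∈-lookup {xs = edgeLabels} j))

  edgeAt-∈ : (j : Fin #E) → edgeAt j ∈ edgeList G
  edgeAt-∈ j = proj₁ (proj₂ (∈-map⁻ inj₂ (∈-lookup {xs = edgeLabels} j)))

  label-edgePos : (j : Fin #E) → label (edgePos j) ≡ inj₂ (edgeAt j)
  label-edgePos j = trans (lookup-rightPos vertexLabels edgeLabels j) (proj₂ (proj₂ (∈-map⁻ inj₂ (∈-lookup {xs = edgeLabels} j))))

  vertexAt-injective : {i i′ : Slot} → vertexAt i ≡ vertexAt i′ → i ≡ i′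
  vertexAt-injective {i} {i′} eq = lookup-injective (map⁺ inj₁-injective (allFin⁺ (size G))) (begin
    lookup vertexLabels i    ≡⟨ lookup-leftPos vertexLabels edgeLabels i ⟨
    label (vertexPos i)      ≡⟨ label-vertexPos i ⟩
    inj₁ (vertexAt i)        ≡⟨ cong inj₁ eq ⟩
    inj₁ (vertexAt i′)       ≡⟨ label-vertexPos i′ ⟨
    label (vertexPos i′)     ≡⟨ lookup-leftPos vertexLabels edgeLabels i′ ⟩
    lookup vertexLabels i′   ∎)
    where open ≡-Reasoning

  vertexSlot : Vertex → Slot
  vertexSlot a = Any.index (∈-map⁺ inj₁ (∈-allFin a))

  vertexAt-vertexSlot : (a : Vertex) → vertexAt (vertexSlot a) ≡ a
  vertexAt-vertexSlot a = inj₁-injective (trans (sym (label-vertexPos (vertexSlot a)))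
    (trans (lookup-leftPos vertexLabels edgeLabels (vertexSlot a)) (sym (lookup-index (∈-map⁺ inj₁ (∈-allFin a))))))

  vertexIndex : Vertex → Fin (size M)
  vertexIndex a = vertexPos (vertexSlot a)

  label-vertexIndex : (a : Vertex) → label (vertexIndex a) ≡ inj₁ a
  label-vertexIndex a = trans (label-vertexPos (vertexSlot a)) (cong inj₁ (vertexAt-vertexSlot a))

  vertexIndex-injective : {a b : Vertex} → vertexIndex a ≡ vertexIndex b → a ≡ b
  vertexIndex-injective {a} {b} eq = inj₁-injective (trans (sym (label-vertexIndex a)) (trans (cong label eq) (label-vertexIndex b)))

  vertexIndex≢edgePos : (a : Vertex) (j : Fin #E) → vertexIndex a ≢ edgePos j
  vertexIndex≢edgePos a j eq = contradiction (trans (sym (label-vertexIndex a)) (trans (cong label eq) (label-edgePos j))) λ ()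

  adj⇒middleAdj : {x y : Fin (size M)} {ℓ ℓ′ : Label} → label x ≡ ℓ → label y ≡ ℓ′ →
               adj M x y ≡ true → middleAdj G ℓ ℓ′ ≡ true
  adj⇒middleAdj refl refl xy = xy

  middleAdj⇒adj : {x y : Fin (size M)} {ℓ ℓ′ : Label} → label x ≡ ℓ → label y ≡ ℓ′ →
               middleAdj G ℓ ℓ′ ≡ true → adj M x y ≡ true
  middleAdj⇒adj refl refl ℓℓ′ = ℓℓ′

  incident⇒adj : {v : Vertex} {e : Edge} → v ∈ₑ e → middleAdj G (inj₁ v) (inj₂ e) ≡ true
  incident⇒adj {v} {e} (inj₁ v≡a) rewrite dec-true (v ≟ proj₁ e) v≡a = refl
  incident⇒adj {v} {e} (inj₂ v≡b) rewrite dec-true (v ≟ proj₂ e) v≡b = ∨-zeroʳ (does (v ≟ proj₁ e))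

  adj⇒incident : {v : Vertex} {e : Edge} → middleAdj G (inj₁ v) (inj₂ e) ≡ true → v ∈ₑ e
  adj⇒incident {v} {e} ve with v ≟ proj₁ e | v ≟ proj₂ e
  ... | yes v≡a | _       = inj₁ v≡a
  ... | no _    | yes v≡b = inj₂ v≡b
  ... | no _    | no _    = contradiction ve λ ()

  middleAdj-irrefl : (ℓ : Label) → middleAdj G ℓ ℓ ≡ false
  middleAdj-irrefl (inj₁ v)       = refl
  middleAdj-irrefl (inj₂ (a , b)) rewrite dec-true (a ≟ a) refl | dec-true (b ≟ b) refl = refl

  sharedEndpoint⇒adj : {e f : Edge} {x : Vertex} → e ≢ f → x ∈ₑ e → x ∈ₑ f → middleAdj G (inj₂ e) (inj₂ f) ≡ true
  sharedEndpoint⇒adj {a , b} {c , d} e≢f x∈e x∈f = cong₂ _∧_ distinct (shared x∈e x∈f)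
    where
    distinct : not (does (a ≟ c) ∧ does (b ≟ d)) ≡ true
    distinct with a ≟ c | b ≟ d
    ... | yes refl | yes refl = contradiction refl e≢f
    ... | yes _    | no _     = refl
    ... | no _     | _        = refl

    true∨ : ∀ {x} y → x ≡ true → x ∨ y ≡ true
    true∨ y refl = refl

    ∨true : ∀ x {y} → y ≡ true → x ∨ y ≡ true
    ∨true x refl = ∨-zeroʳ x

    shared : ∀ {x} → x ∈ₑ (a , b) → x ∈ₑ (c , d) →
             does (a ≟ c) ∨ does (a ≟ d) ∨ does (b ≟ c) ∨ does (b ≟ d) ≡ true
    shared (inj₁ refl) (inj₁ refl) = true∨ _ (dec-true (a ≟ c) refl)
    shared (inj₁ refl) (inj₂ refl) = ∨true (does (a ≟ c)) (true∨ _ (dec-true (a ≟ d) refl))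
    shared (inj₂ refl) (inj₁ refl) = ∨true (does (a ≟ c)) (∨true (does (a ≟ d)) (true∨ _ (dec-true (b ≟ c) refl)))
    shared (inj₂ refl) (inj₂ refl) = ∨true (does (a ≟ c)) (∨true (does (a ≟ d)) (∨true (does (b ≟ c)) (dec-true (b ≟ d) refl)))

  labelIndex : {ℓ : Label} → ℓ ∈ middleLabels G → Fin (size M)
  labelIndex = Any.index

  label-labelIndex : {ℓ : Label} (ℓ∈ : ℓ ∈ middleLabels G) → label (labelIndex ℓ∈) ≡ ℓ
  label-labelIndex ℓ∈ = sym (lookup-index ℓ∈)

  vertexLabel-∈ : (a : Vertex) → inj₁ a ∈ middleLabels G
  vertexLabel-∈ a = ∈-++⁺ˡ (∈-map⁺ inj₁ (∈-allFin a))

  edgeLabel-∈ : {e : Edge} → e ∈ edgeList G → inj₂ e ∈ middleLabels G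
  edgeLabel-∈ e∈ = ∈-++⁺ʳ vertexLabels (∈-map⁺ inj₂ e∈)

  LabelsWithinTwo : Label → Label → Set
  LabelsWithinTwo ℓ ℓ′ = middleAdj G ℓ ℓ′ ≡ true
                       ⊎ ∃ λ ℓ″ → ℓ″ ∈ middleLabels G × middleAdj G ℓ″ ℓ ≡ true × middleAdj G ℓ″ ℓ′ ≡ true

  withinTwo-labels : {x y : Fin (size M)} {ℓ ℓ′ : Label} → label x ≡ ℓ → label y ≡ ℓ′ →
                     LabelsWithinTwo ℓ ℓ′ → WithinTwo M x y
  withinTwo-labels refl refl (inj₁ xy) = inj₁ xy
  withinTwo-labels refl refl (inj₂ (ℓ″ , ℓ″∈ , ℓ″x , ℓ″y)) =
    inj₂ (labelIndex ℓ″∈ , middleAdj⇒adj (label-labelIndex ℓ″∈) refl ℓ″x , middleAdj⇒adj (label-labelIndex ℓ″∈) refl ℓ″y)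


distinct-pair : {k : ℕ} → 2 ≤ k → ∃ λ (i : Fin k) → ∃ λ (i′ : Fin k) → i ≢ i′
distinct-pair (s≤s (s≤s z≤n)) = zero , suc zero , λ ()

↑ˡ≢↑ʳ : {m n : ℕ} (i : Fin m) (j : Fin n) → i ↑ˡ n ≢ m ↑ʳ j
↑ˡ≢↑ʳ {m} {n} i j eq = contradiction (trans (sym (splitAt-↑ˡ m i n)) (trans (cong (splitAt m) eq) (splitAt-↑ʳ m n j))) λ ()

module MiddleColouring (G : Graph) {k : ℕ} (part : Fin (size G) → Fin k)
                       (part-proper : ∀ {a b} → adj G a b ≡ true → part a ≢ part b) where
  open MiddleGraph G

  colour : Fin (size M) → Fin (k + #E)
  colour x = [ (λ i → part (vertexAt i) ↑ˡ #E) , (k ↑ʳ_) ]′ (splitPos vertexLabels edgeLabels x)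

  colour-vertexPos : (i : Slot) → colour (vertexPos i) ≡ part (vertexAt i) ↑ˡ #E
  colour-vertexPos i = cong [ (λ i → part (vertexAt i) ↑ˡ #E) , (k ↑ʳ_) ]′ (splitPos-leftPos vertexLabels edgeLabels i)

  colour-edgePos : (j : Fin #E) → colour (edgePos j) ≡ k ↑ʳ j
  colour-edgePos j = cong [ (λ i → part (vertexAt i) ↑ˡ #E) , (k ↑ʳ_) ]′ (splitPos-rightPos vertexLabels edgeLabels j)

  vertex≢edge-colour : (i : Slot) (j : Fin #E) → colour (vertexPos i) ≢ colour (edgePos j)
  vertex≢edge-colour i j same = ↑ˡ≢↑ʳ _ j (trans (sym (colour-vertexPos i)) (trans same (colour-edgePos j)))

  edge-colour-injective : {j j′ : Fin #E} → colour (edgePos j) ≡ colour (edgePos j′) → j ≡ j′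
  edge-colour-injective {j} {j′} same = ↑ʳ-injective k j j′ (trans (sym (colour-edgePos j)) (trans same (colour-edgePos j′)))

  endpoint-by-part : {e : Edge} {a b : Vertex} → e ∈ edgeList G → a ∈ₑ e → b ∈ₑ e → part a ≡ part b → a ≡ b
  endpoint-by-part e∈ (inj₁ refl) (inj₁ refl) _  = refl
  endpoint-by-part e∈ (inj₂ refl) (inj₂ refl) _  = refl
  endpoint-by-part e∈ (inj₁ refl) (inj₂ refl) pa≡pb = contradiction pa≡pb (part-proper (∈-edgeList⁻ e∈))
  endpoint-by-part e∈ (inj₂ refl) (inj₁ refl) pa≡pb = contradiction (sym pa≡pb) (part-proper (∈-edgeList⁻ e∈))

  colour-proper : ∀ x y → adj M x y ≡ true → colour x ≢ colour y
  colour-proper x y xy same with middlePosition x | middlePosition y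
  ... | left i  | left i′  = contradiction (adj⇒middleAdj (label-vertexPos i) (label-vertexPos i′) xy) λ ()
  ... | left i  | right j  = vertex≢edge-colour i j same
  ... | right j | left i   = vertex≢edge-colour i j (sym same)
  ... | right j | right j′ with edge-colour-injective same
  ...   | refl = contradiction (trans (sym xy) (middleAdj-irrefl (label (edgePos j)))) λ ()

  colour-neighbourInjective : ∀ x → NeighbourInjective M colour x
  colour-neighbourInjective x {u} {w} xu xw same with middlePosition u | middlePosition w
  ... | left i  | right j  = contradiction same (vertex≢edge-colour i j)
  ... | right j | left i   = contradiction (sym same) (vertex≢edge-colour i j)
  ... | right j | right j′ = cong edgePos (edge-colour-injective same)
  ... | left i  | left i′ with middlePosition x
  ...   | left i₀ = contradiction (adj⇒middleAdj (label-vertexPos i₀) (label-vertexPos i) xu) λ ()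
  ...   | right j = cong vertexPos (vertexAt-injective (endpoint-by-part (edgeAt-∈ j)
          (adj⇒incident (adj⇒middleAdj (label-edgePos j) (label-vertexPos i) xu))
          (adj⇒incident (adj⇒middleAdj (label-edgePos j) (label-vertexPos i′) xw))
          (↑ˡ-injective #E _ _ (trans (sym (colour-vertexPos i)) (trans same (colour-vertexPos i′))))))

  colour-surjective : (∀ i → ∃ λ a → part a ≡ i) → ∀ c → ∃ λ x → colour x ≡ c
  colour-surjective part-surjective c with splitAt k c in split≡
  ... | inj₂ j = edgePos j , trans (colour-edgePos j) (splitAt⁻¹-↑ʳ split≡)
  ... | inj₁ i = vertexPos (vertexSlot a) , (begin
    colour (vertexPos (vertexSlot a))      ≡⟨ colour-vertexPos (vertexSlot a) ⟩
    part (vertexAt (vertexSlot a)) ↑ˡ #E   ≡⟨ cong (λ v → part v ↑ˡ #E) (vertexAt-vertexSlot a) ⟩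
    part a ↑ˡ #E                           ≡⟨ cong (_↑ˡ #E) pa≡i ⟩
    i ↑ˡ #E                                ≡⟨ splitAt⁻¹-↑ˡ split≡ ⟩
    c                                      ∎)
    where
    open ≡-Reasoning
    a = proj₁ (part-surjective i)
    pa≡i = proj₂ (part-surjective i)

  middleColouring : (∀ i → ∃ λ a → part a ≡ i) → 0 < maxDeg M → CondColouring M (k + #E) (maxDeg M)
  middleColouring part-surjective Δ>0 = record
    { k'-pos = <-≤-trans Δ>0 Δ≤colours
    ; r-pos  = Δ>0
    ; r≤Δ    = ≤-refl
    ; r≤k'   = Δ≤colours
    ; colour = colour
    ; surj   = colour-surjective part-surjective
    ; proper = colour-proper
    ; cond   = λ v → ≤-trans (m⊓n≤m _ _) (deg≤nbColours v)
    }
    where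
    deg≤nbColours : ∀ v → deg M v ≤ nbColours M colour v
    deg≤nbColours v = neighbourInjective⇒deg≤nbColours M colour v (colour-neighbourInjective v)
    Δ≤colours : maxDeg M ≤ k + #E
    Δ≤colours = maxDeg≤ M λ v → ≤-trans (deg≤nbColours v) (nbColours≤k M colour v)

partitionGraph : {k : ℕ} (N : ℕ) → (Fin N → Fin k) → Graph
partitionGraph N part = record { size = N ; adj = λ a b → not (does (part a ≟ part b)) }

module PartitionGraph {k N : ℕ} (part : Fin N → Fin k) where
  G : Graph
  G = partitionGraph N part

  open MiddleGraph G

  adj-sym : ∀ a b → adj G a b ≡ adj G b a
  adj-sym a b with part a ≟ part b
  ... | yes pa≡pb = sym (cong not (dec-true (part b ≟ part a) (sym pa≡pb)))
  ... | no  pa≢pb = sym (cong not (dec-false (part b ≟ part a) (pa≢pb ∘ sym)))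

  adj-irrefl : ∀ a → adj G a a ≡ false
  adj-irrefl a = cong not (dec-true (part a ≟ part a) refl)

  #edges≡⌊degreeSum/2⌋ : length (edgeList G) ≡ ⌊ sumOver (allFin N) (deg G) /2⌋
  #edges≡⌊degreeSum/2⌋ = trans (n≡⌊n+n/2⌋ _) (cong ⌊_/2⌋ (sym (handshake G adj-sym adj-irrefl)))

  part-proper : ∀ {a b} → adj G a b ≡ true → part a ≢ part b
  part-proper {a} {b} ab pa≡pb = contradiction (trans (sym ab) (cong not (dec-true (part a ≟ part b) pa≡pb))) λ ()

  adj-parts : ∀ {a b} → part a ≢ part b → adj G a b ≡ true
  adj-parts {a} {b} pa≢pb = cong not (dec-false (part a ≟ part b) pa≢pb)

  edgeBetween : {a b : Vertex} → part a ≢ part b → ∃ λ e → e ∈ edgeList G × a ∈ₑ e × b ∈ₑ e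
  edgeBetween {a} {b} pa≢pb with <-cmp (toℕ a) (toℕ b)
  ... | tri< a<b _ _ = (a , b) , ∈-edgeList⁺ (adj-parts pa≢pb) a<b , inj₁ refl , inj₂ refl
  ... | tri> _ _ b<a = (b , a) , ∈-edgeList⁺ (adj-parts (pa≢pb ∘ sym)) b<a , inj₂ refl , inj₁ refl
  ... | tri≈ _ a≡b _ = contradiction (cong part (toℕ-injective a≡b)) pa≢pb

  -- The two endpoints of an edge lie in different parts.
  endpointOutside : {e : Edge} → e ∈ edgeList G → (i : Fin k) → ∃ λ x → x ∈ₑ e × part x ≢ i
  endpointOutside {a , b} e∈ i with part a ≟ i
  ... | no  pa≢i = a , inj₁ refl , pa≢i
  ... | yes refl = b , inj₂ refl , part-proper (∈-edgeList⁻ e∈) ∘ sym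

  vertices-withinTwo : {a b : Vertex} → part a ≢ part b → LabelsWithinTwo (inj₁ a) (inj₁ b)
  vertices-withinTwo pa≢pb = let e , e∈ , a∈e , b∈e = edgeBetween pa≢pb in
    inj₂ (inj₂ e , edgeLabel-∈ e∈ , incident⇒adj a∈e , incident⇒adj b∈e)

  vertex-edge-withinTwo : (a : Vertex) {e : Edge} → e ∈ edgeList G → LabelsWithinTwo (inj₁ a) (inj₂ e)
  vertex-edge-withinTwo a {e} e∈ with a ∈ₑ? e
  ... | yes a∈e = inj₁ (incident⇒adj a∈e)
  ... | no  a∉e =
    let x , x∈e , px≢pa  = endpointOutside e∈ (part a)
        g , g∈ , a∈g , x∈g = edgeBetween (px≢pa ∘ sym)
        g≢e : g ≢ e
        g≢e g≡e = a∉e (subst (a ∈ₑ_) g≡e a∈g)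
    in inj₂ (inj₂ g , edgeLabel-∈ g∈ , incident⇒adj a∈g , sharedEndpoint⇒adj g≢e x∈g x∈e)

  edges-withinTwo : {e f : Edge} → e ∈ edgeList G → f ∈ edgeList G → LabelsWithinTwo (inj₂ e) (inj₂ f)
  edges-withinTwo {e} {f} e∈ f∈ with ≡-dec _≟_ _≟_ e f | proj₁ e ∈ₑ? f | proj₂ e ∈ₑ? f
  ... | yes refl | _       | _       = inj₂ (inj₁ (proj₁ e) , vertexLabel-∈ _ , incident⇒adj {e = e} (inj₁ refl) , incident⇒adj {e = e} (inj₁ refl))
  ... | no e≢f   | yes a∈f | _       = inj₁ (sharedEndpoint⇒adj e≢f (inj₁ refl) a∈f)
  ... | no e≢f   | no _    | yes b∈f = inj₁ (sharedEndpoint⇒adj e≢f (inj₂ refl) b∈f)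
  ... | no _     | no a∉f  | no b∉f  =
    let y = proj₁ f
        x , x∈e , px≢py  = endpointOutside e∈ (part y)
        g , g∈ , x∈g , y∈g = edgeBetween px≢py
        g≢e : g ≢ e
        g≢e g≡e = disjoint (subst (y ∈ₑ_) g≡e y∈g) (inj₁ refl)
        g≢f : g ≢ f
        g≢f g≡f = disjoint x∈e (subst (x ∈ₑ_) g≡f x∈g)
    in inj₂ (inj₂ g , edgeLabel-∈ g∈ , sharedEndpoint⇒adj g≢e x∈g x∈e , sharedEndpoint⇒adj g≢f y∈g (inj₁ refl))
    where
    disjoint : ∀ {z} → z ∈ₑ e → ¬ z ∈ₑ f
    disjoint (inj₁ refl) = a∉f
    disjoint (inj₂ refl) = b∉f

  module _ (part-surjective : ∀ i → ∃ λ a → part a ≡ i) where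

    rep : Fin k → Vertex
    rep i = proj₁ (part-surjective i)

    part-rep : ∀ i → part (rep i) ≡ i
    part-rep i = proj₂ (part-surjective i)

    transversal : Fin k ⊎ Fin #E → Fin (size M)
    transversal (inj₁ i) = vertexIndex (rep i)
    transversal (inj₂ j) = edgePos j

    transversal-separated : ∀ {p q} → p ≢ q → transversal p ≢ transversal q × WithinTwo M (transversal p) (transversal q)
    transversal-separated {inj₁ i} {inj₁ i′} p≢q =
      (λ eq → parts-differ (cong part (vertexIndex-injective eq))) ,
      withinTwo-labels (label-vertexIndex _) (label-vertexIndex _) (vertices-withinTwo parts-differ)
      where
      parts-differ : part (rep i) ≢ part (rep i′)
      parts-differ eq = p≢q (cong inj₁ (trans (sym (part-rep i)) (trans eq (part-rep i′))))
    transversal-separated {inj₁ i} {inj₂ j} _ =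
      vertexIndex≢edgePos (rep i) j ,
      withinTwo-labels (label-vertexIndex _) (label-edgePos j) (vertex-edge-withinTwo _ (edgeAt-∈ j))
    transversal-separated {inj₂ j} {inj₁ i} _ =
      vertexIndex≢edgePos (rep i) j ∘ sym ,
      withinTwo-labels (label-edgePos j) (label-vertexIndex _) (swap (vertex-edge-withinTwo _ (edgeAt-∈ j)))
      where
      swap : ∀ {a e} → LabelsWithinTwo (inj₁ a) (inj₂ e) → LabelsWithinTwo (inj₂ e) (inj₁ a)
      swap (inj₁ ae)                 = inj₁ ae
      swap (inj₂ (ℓ , ℓ∈ , ℓa , ℓe)) = inj₂ (ℓ , ℓ∈ , ℓe , ℓa)
    transversal-separated {inj₂ j} {inj₂ j′} p≢q =
      (λ eq → p≢q (cong inj₂ (rightPos-injective vertexLabels edgeLabels eq))) ,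
      withinTwo-labels (label-edgePos j) (label-edgePos j′) (edges-withinTwo (edgeAt-∈ j) (edgeAt-∈ j′))

    transversal-clique² : Clique² M (transversal ∘ splitAt k)
    transversal-clique² {s} {t} s≢t = transversal-separated {splitAt k s} {splitAt k t} λ eq →
      s≢t (trans (sym (join-splitAt k #E s)) (trans (cong (join k #E) eq) (join-splitAt k #E t)))

    0<maxDeg : 2 ≤ k → 0 < maxDeg M
    0<maxDeg 2≤k =
      let i , i′ , i≢i′ = distinct-pair 2≤k
          e , e∈ , a∈e , _ = edgeBetween {rep i} {rep i′} λ eq → i≢i′ (trans (sym (part-rep i)) (trans eq (part-rep i′)))
      in adj⇒0<maxDeg M (middleAdj⇒adj (label-vertexIndex (rep i)) (label-labelIndex (edgeLabel-∈ e∈)) (incident⇒adj a∈e))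

    middle-χΔ : 2 ≤ k → IsCondChromatic M (maxDeg M) (k + length (edgeList G))
    middle-χΔ 2≤k = subst (λ m → IsCondChromatic M (maxDeg M) (k + m)) (length-map inj₂ (edgeList G))
      ( MiddleColouring.middleColouring G part part-proper part-surjective (0<maxDeg 2≤k)
      , λ _ c → clique²≤colours M c transversal-clique²)

-- completeMultipartite k n is definitionally partitionGraph N part.
module CompleteMultipartite (k : ℕ) (n : Fin k → ℕ) where

  N : ℕ
  N = length (kpLabels k n)

  part : Fin N → Fin k
  part a = proj₁ (lookup (kpLabels k n) a)

  open PartitionGraph part public

  sumOver-kpLabels : (g : Fin k → ℕ) → sumOver (kpLabels k n) (g ∘ proj₁) ≡ sumFin k (λ i → n i * g i)
  sumOver-kpLabels g = trans (sumOver-concatMap _ (allFin k) (g ∘ proj₁)) (sumOver-cong (allFin k) part-sum)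
    where
    part-sum : ∀ i → sumOver (map (i ,_) (upTo (n i))) (g ∘ proj₁) ≡ n i * g i
    part-sum i = trans (sumOver-map (i ,_) (upTo (n i)) (g ∘ proj₁))
      (trans (sumOver-const (upTo (n i)) (g i)) (cong (_* g i) (length-upTo (n i))))

  part-surjective : (∀ i → 1 ≤ n i) → ∀ i → ∃ λ a → part a ≡ i
  part-surjective n≥1 i = Any.index first , sym (cong proj₁ (lookup-index first))
    where
    first : (i , 0) ∈ kpLabels k n
    first = ∈-concatMap⁺ _ (Any.map (λ { refl → ∈-map⁺ (i ,_) (∈-upTo⁺ (n≥1 i)) }) (∈-allFin i))

  deg≡sum∸part : ∀ v → deg G v ≡ sumFin k n ∸ n (part v)
  deg≡sum∸part v = begin
    deg G v                                                                ≡⟨ count≡sumOver-iverson (adj G v) (allFin N) ⟩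
    sumOver (allFin N) (iverson ∘ adj G v)                                 ≡⟨ sumOver-lookup (kpLabels k n) (λ ℓ → otherPart (proj₁ ℓ)) ⟩
    sumOver (kpLabels k n) (λ ℓ → otherPart (proj₁ ℓ))                     ≡⟨ sumOver-kpLabels otherPart ⟩
    sumFin k (λ i → n i * otherPart i)                                     ≡⟨ m+n∸n≡m _ (n (part v)) ⟨
    sumFin k (λ i → n i * otherPart i) + n (part v) ∸ n (part v)           ≡⟨ cong (_∸ n (part v)) (sumFin-except k n (part v)) ⟩
    sumFin k n ∸ n (part v)                                                ∎
    where
    open ≡-Reasoning
    otherPart : Fin k → ℕ
    otherPart i = iverson (not (does (part v ≟ i)))

  degreeSum : sumOver (allFin N) (deg G) ≡ sumFin k (λ i → n i * (sumFin k n ∸ n i))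
  degreeSum = trans (sumOver-cong (allFin N) deg≡sum∸part)
    (trans (sumOver-lookup (kpLabels k n) (λ ℓ → sumFin k n ∸ n (proj₁ ℓ))) (sumOver-kpLabels (λ i → sumFin k n ∸ n i)))

proposition3p6 : (k : ℕ) (n : Fin k → ℕ) → 2 ≤ k → (∀ i → 1 ≤ n i) →
    IsCondChromatic (middleGraph (completeMultipartite k n))
      (maxDeg (middleGraph (completeMultipartite k n)))
      (k + ⌊ sumFin k (λ i → n i * (sumFin k n ∸ n i)) /2⌋)
proposition3p6 k n 2≤k n≥1 =
  subst (λ m → IsCondChromatic M (maxDeg M) (k + m)) #edges≡ (middle-χΔ (part-surjective n≥1) 2≤k)
  where
  open CompleteMultipartite k n
  open MiddleGraph G using (M)
  #edges≡ : length (edgeList G) ≡ ⌊ sumFin k (λ i → n i * (sumFin k n ∸ n i)) /2⌋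
  #edges≡ = trans #edges≡⌊degreeSum/2⌋ (cong ⌊_/2⌋ degreeSum)
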